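{- Let $f: \mathbb{R}/\mathbb{Z} \to \mathbb{R}$ be a continuous, piecewise-linear function with finitely many pieces, each with rational slope and rational endpoints, and let $b$ be a fixed rational number. Then there is a natural number $M$ (depending on $f,b$) such that for each integer $0 \leq Q <M$ there is a nonnegative rational number $\gamma_Q$ (depending on $f,b,Q$) such that $$\min_{t \in b/q+\langle 1/q \rangle} f(t)=\min_{t \in \mathbb{R}/\mathbb{Z}}f(t)+\frac{\gamma_Q}{q}$$ for all sufficiently large natural numbers $q$ satisfying $q \equiv Q \pmod{M}$.
   Context: For $q \in \mathbb{N}$ and rational $b$, $b/q+\langle 1/q \rangle$ denotes the subset $\{b/q+r/q : r \in \mathbb{Z}\}$ of $\mathbb{R}/\mathbb{Z}$ (taken modulo $1$).
   Formalization: The function f is defined at the rational points of ℝ/ℤ and takes values in ℚ rather than ℝ, and its minimum over ℝ/ℤ is taken over rational points. -}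

module Defs where

open import Data.Nat as ℕ using (ℕ; NonZero)
open import Data.Integer as ℤ using (ℤ; +_)
open import Data.Rational using (ℚ; 0ℚ; 1ℚ; _+_; _*_; _-_; _≤_; _<_; _/_)
open import Data.Fin using (Fin; zero; suc; inject₁; fromℕ)
open import Data.Unit using (⊤)
open import Data.Product using (Σ; _×_; ∃)
open import Relation.Binary.PropositionalEquality using (_≡_)

ℤ→ℚ : ℤ → ℚ
ℤ→ℚ z = z / 1

-- Continuity is
-- automatic since f is a single function and the formula holds on closed pieces.
record IsPL (f : ℚ → ℚ) : Set where
  field
    periodic : ∀ t → f (t + 1ℚ) ≡ f t
    n        : ℕ
    xs       : Fin (ℕ.suc n) → ℚ
    slopes   : Fin n → ℚ
    x-first  : xs zero ≡ 0ℚ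
    x-last   : xs (fromℕ n) ≡ 1ℚ
    x-incr   : ∀ i → xs (inject₁ i) < xs (suc i)
    affine   : ∀ i t → xs (inject₁ i) ≤ t → t ≤ xs (suc i) →
               f t ≡ f (xs (inject₁ i)) + slopes i * (t - xs (inject₁ i))

IsMinOn : (ℚ → Set) → (ℚ → ℚ) → ℚ → Set
IsMinOn S f m = (∀ t → S t → m ≤ f t) × (Σ ℚ λ t → S t × (f t ≡ m))

-- The whole circle ℝ/ℤ (represented by its rational points).
Everywhere : ℚ → Set
Everywhere _ = ⊤

-- t ∈ b/q + ⟨1/q⟩, i.e. t = b/q + r/q for some integer r (mod 1 is
-- harmless since f is 1-periodic and r ranges over all of ℤ).
InCoset : ℚ → ℕ → ℚ → Set
InCoset b q t = Σ ℤ λ r → t * ℤ→ℚ (+ q) ≡ b + ℤ→ℚ r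

{-# OPTIONS --safe #-}

-- Let M be a common denominator of the breakpoints and q = Q + kM, so that q·a ≡ Q·a (mod 1)
-- for every breakpoint a.  If t lies in the coset b/q + ⟨1/q⟩ and in a piece ending at a, its
-- distance d ≥ 0 from a satisfies q·d ≡ ±(b − Q·a) (mod 1), the sign depending on which end a
-- is; hence q·d ≥ frac(±(b − Q·a)), with equality attained in the coset once q is large enough
-- for that d to fit in the piece.  On the piece f = f(a) + s·d, where s is the slope going into
-- the piece, and s ≥ 0 when f(a) = m.  So γ_Q is the least s·frac(±(b − Q·a)) over the piece
-- ends a with f(a) = m.  Every point of a piece is at least as high as the lower end of the
-- piece, and ends with f(a) > m exceed m by a fixed amount, hence by γ_Q/q for large q.

module Submission where

open import Defs
open import Data.Nat as ℕ using (ℕ; NonZero)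
open import Data.Integer using (+_)
open import Data.Rational using (ℚ; 0ℚ; _+_; _*_; _≤_; _/_)
open import Data.Product using (Σ; _×_; _,_; proj₁; proj₂)
open import Relation.Binary.PropositionalEquality

open import Data.Empty using (⊥-elim)
open import Data.Fin using (Fin; zero; suc; inject₁; fromℕ)
open import Data.List using (List; _∷_; []; filter; cartesianProduct; allFin)
open import Data.List.Membership.Propositional using (_∈_)
open import Data.List.Membership.Propositional.Properties using (∈-filter⁺; ∈-cartesianProduct⁺; ∈-allFin)
open import Data.List.Relation.Unary.All using (lookup)
open import Data.List.Relation.Unary.All.Properties using (all-filter)
open import Data.List.Relation.Unary.Any using (here; there)
open import Function using (_∘_)
open import Relation.Binary.Bundles using (DecTotalOrder; Setoid)
open import Relation.Nullary using (Dec; yes; no)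
open import Relation.Unary using (Decidable)

import Data.Nat.Properties as ℕ
open import Data.Integer as ℤ using (ℤ; -[1+_])
import Data.Integer.DivMod as ℤ
import Data.Integer.Properties as ℤ
import Data.Integer.Tactic.RingSolver as ℤ-Solver
open import Data.Rational as ℚ using (1ℚ; _-_; -_; _<_; ↥_; ↧ₙ_; floor; toℚᵘ)
import Data.Rational.Properties as ℚ
open import Data.Rational.Solver using (module +-*-Solver)
open +-*-Solver using (solve; _:=_; _:+_; _:*_; :-_; _:-_; con)
open import Data.Rational.Unnormalised as ℚᵘ using (mkℚᵘ; *≡*; *≤*; *<*)
import Data.Rational.Unnormalised.Properties as ℚᵘ
open import Data.List.Extrema (DecTotalOrder.totalOrder ℚ.≤-decTotalOrder)
  using (argmin; argmin-all; f[argmin]≤f[xs])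

≤⇒0≤- : ∀ {p q} → p ≤ q → 0ℚ ≤ q - p
≤⇒0≤- {p} {q} p≤q = subst (_≤ q - p) (ℚ.+-inverseʳ p) (ℚ.+-monoˡ-≤ (- p) p≤q)

<⇒0<- : ∀ {p q} → p < q → 0ℚ < q - p
<⇒0<- {p} {q} p<q = subst (_< q - p) (ℚ.+-inverseʳ p) (ℚ.+-monoˡ-< (- p) p<q)

p≤p+q : ∀ p {q} → 0ℚ ≤ q → p ≤ p + q
p≤p+q p {q} 0≤q = subst (_≤ p + q) (ℚ.+-identityʳ p) (ℚ.+-monoʳ-≤ p 0≤q)

*-monoˡ-≤-0≤ : ∀ {r p q} → 0ℚ ≤ r → p ≤ q → r * p ≤ r * q
*-monoˡ-≤-0≤ {r} 0≤r = ℚ.*-monoˡ-≤-nonNeg r {{ℚ.nonNegative 0≤r}}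

*-monoʳ-≤-0≤ : ∀ {r p q} → 0ℚ ≤ r → p ≤ q → p * r ≤ q * r
*-monoʳ-≤-0≤ {r} 0≤r = ℚ.*-monoʳ-≤-nonNeg r {{ℚ.nonNegative 0≤r}}

nonneg-* : ∀ {p q} → 0ℚ ≤ p → 0ℚ ≤ q → 0ℚ ≤ p * q
nonneg-* {p} {q} 0≤p 0≤q =
  ℚ.nonNegative⁻¹ _ {{ℚ.nonNeg*nonNeg⇒nonNeg p {{ℚ.nonNegative 0≤p}} q {{ℚ.nonNegative 0≤q}}}}

ι : ℤ → ℚ
ι = ℤ→ℚ

toℚᵘ-/ : ∀ i k → toℚᵘ (i / ℕ.suc k) ℚᵘ.≃ mkℚᵘ i k
toℚᵘ-/ i k = ℚ.toℚᵘ-fromℚᵘ (mkℚᵘ i k)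

ι-+ : ∀ i j → ι (i ℤ.+ j) ≡ ι i + ι j
ι-+ i j = ℚ.toℚᵘ-injective (begin
  toℚᵘ (ι (i ℤ.+ j))           ≈⟨ toℚᵘ-/ (i ℤ.+ j) 0 ⟩
  mkℚᵘ (i ℤ.+ j) 0             ≈⟨ *≡* cross ⟩
  mkℚᵘ i 0 ℚᵘ.+ mkℚᵘ j 0       ≈⟨ ℚᵘ.+-cong (toℚᵘ-/ i 0) (toℚᵘ-/ j 0) ⟨
  toℚᵘ (ι i) ℚᵘ.+ toℚᵘ (ι j)   ≈⟨ ℚ.toℚᵘ-homo-+ (ι i) (ι j) ⟨
  toℚᵘ (ι i + ι j)             ∎)
  where
  open ℚᵘ.≃-Reasoning
  cross : (i ℤ.+ j) ℤ.* ℤ.1ℤ ≡ (i ℤ.* ℤ.1ℤ ℤ.+ j ℤ.* ℤ.1ℤ) ℤ.* ℤ.1ℤ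
  cross = ℤ-Solver.solve (i ∷ j ∷ [])

ι-* : ∀ i j → ι (i ℤ.* j) ≡ ι i * ι j
ι-* i j = ℚ.toℚᵘ-injective (begin
  toℚᵘ (ι (i ℤ.* j))           ≈⟨ toℚᵘ-/ (i ℤ.* j) 0 ⟩
  mkℚᵘ (i ℤ.* j) 0             ≈⟨ *≡* refl ⟩
  mkℚᵘ i 0 ℚᵘ.* mkℚᵘ j 0       ≈⟨ ℚᵘ.*-cong (toℚᵘ-/ i 0) (toℚᵘ-/ j 0) ⟨
  toℚᵘ (ι i) ℚᵘ.* toℚᵘ (ι j)   ≈⟨ ℚ.toℚᵘ-homo-* (ι i) (ι j) ⟨
  toℚᵘ (ι i * ι j)             ∎)
  where open ℚᵘ.≃-Reasoning

ι-neg : ∀ i → ι (ℤ.- i) ≡ - ι i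
ι-neg i = ℚ.toℚᵘ-injective (begin
  toℚᵘ (ι (ℤ.- i))   ≈⟨ toℚᵘ-/ (ℤ.- i) 0 ⟩
  ℚᵘ.- mkℚᵘ i 0      ≈⟨ ℚᵘ.-‿cong (toℚᵘ-/ i 0) ⟨
  ℚᵘ.- toℚᵘ (ι i)    ≈⟨ ℚ.toℚᵘ-homo‿- (ι i) ⟨
  toℚᵘ (- ι i)       ∎)
  where open ℚᵘ.≃-Reasoning

-1*p≡-p : ∀ p → ι ℤ.-1ℤ * p ≡ - p
-1*p≡-p p = trans (sym (ℚ.neg-distribˡ-* 1ℚ p)) (cong -_ (ℚ.*-identityˡ p))

ι-pos-+ : ∀ m n → ι (+ (m ℕ.+ n)) ≡ ι (+ m) + ι (+ n)
ι-pos-+ m n = trans (cong ι (ℤ.pos-+ m n)) (ι-+ (+ m) (+ n))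

ι-pos-* : ∀ m n → ι (+ (m ℕ.* n)) ≡ ι (+ m) * ι (+ n)
ι-pos-* m n = trans (cong ι (ℤ.pos-* m n)) (ι-* (+ m) (+ n))

ι-mono-≤ : ∀ {i j} → i ℤ.≤ j → ι i ≤ ι j
ι-mono-≤ {i} {j} i≤j = ℚ.toℚᵘ-cancel-≤
  (ℚᵘ.≤-respˡ-≃ (ℚᵘ.≃-sym (toℚᵘ-/ i 0)) (ℚᵘ.≤-respʳ-≃ (ℚᵘ.≃-sym (toℚᵘ-/ j 0))
    (*≤* (ℤ.*-monoʳ-≤-nonNeg ℤ.1ℤ i≤j))))

ι-mono-< : ∀ {i j} → i ℤ.< j → ι i < ι j
ι-mono-< {i} {j} i<j = ℚ.toℚᵘ-cancel-<
  (ℚᵘ.<-respˡ-≃ (ℚᵘ.≃-sym (toℚᵘ-/ i 0)) (ℚᵘ.<-respʳ-≃ (ℚᵘ.≃-sym (toℚᵘ-/ j 0))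
    (*<* (ℤ.*-monoʳ-<-pos ℤ.1ℤ i<j))))

ι-cancel-< : ∀ {i j} → ι i < ι j → i ℤ.< j
ι-cancel-< {i} {j} ιi<ιj
  with ℚᵘ.<-respˡ-≃ (toℚᵘ-/ i 0) (ℚᵘ.<-respʳ-≃ (toℚᵘ-/ j 0) (ℚ.toℚᵘ-mono-< ιi<ιj))
... | *<* i*1<j*1 = ℤ.*-cancelʳ-<-nonNeg ℤ.1ℤ i*1<j*1

ι-ℕ-nonneg : ∀ n → 0ℚ ≤ ι (+ n)
ι-ℕ-nonneg n = ι-mono-≤ {ℤ.0ℤ} {+ n} (ℤ.+≤+ ℕ.z≤n)

ι-suc-pos : ∀ n → 0ℚ < ι (+ ℕ.suc n)
ι-suc-pos n = ι-mono-< {ℤ.0ℤ} {+ ℕ.suc n} (ℤ.+<+ (ℕ.s≤s ℕ.z≤n))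

/-*-denominator : ∀ i d .{{_ : NonZero d}} → (i / d) * ι (+ d) ≡ ι i
/-*-denominator i (ℕ.suc k) = ℚ.toℚᵘ-injective (begin
  toℚᵘ ((i / ℕ.suc k) * ι (+ ℕ.suc k))           ≈⟨ ℚ.toℚᵘ-homo-* (i / ℕ.suc k) (ι (+ ℕ.suc k)) ⟩
  toℚᵘ (i / ℕ.suc k) ℚᵘ.* toℚᵘ (ι (+ ℕ.suc k))   ≈⟨ ℚᵘ.*-cong (toℚᵘ-/ i k) (toℚᵘ-/ (+ ℕ.suc k) 0) ⟩
  mkℚᵘ i k ℚᵘ.* mkℚᵘ (+ ℕ.suc k) 0               ≈⟨ *≡* cross ⟩
  mkℚᵘ i 0                                        ≈⟨ toℚᵘ-/ i 0 ⟨
  toℚᵘ (ι i)                                      ∎)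
  where
  open ℚᵘ.≃-Reasoning
  cross : (i ℤ.* + ℕ.suc k) ℤ.* ℤ.1ℤ ≡ i ℤ.* + (ℕ.suc k ℕ.* 1)
  cross = trans (ℤ.*-identityʳ _) (cong (λ n → i ℤ.* + n) (sym (ℕ.*-identityʳ (ℕ.suc k))))

*-denominator : ∀ p → p * ι (+ ↧ₙ p) ≡ ι (↥ p)
*-denominator p =
  subst (λ r → r * ι (+ ↧ₙ p) ≡ ι (↥ p)) (ℚ.↥p/↧p≡p p) (/-*-denominator (↥ p) (↧ₙ p))

1/q*q : ∀ q .{{_ : NonZero q}} → (+ 1 / q) * ι (+ q) ≡ 1ℚ
1/q*q q = /-*-denominator (+ 1) q

1/q-nonneg : ∀ q .{{_ : NonZero q}} → 0ℚ ≤ + 1 / q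
1/q-nonneg q = ℚ.nonNegative⁻¹ (+ 1 / q) {{ℚ.normalize-nonNeg 1 q}}

*-1/q-≤ : ∀ q .{{_ : NonZero q}} {x y} → x ≤ ι (+ q) * y → x * (+ 1 / q) ≤ y
*-1/q-≤ q {x} {y} x≤qy = begin
  x * (+ 1 / q)               ≤⟨ *-monoʳ-≤-0≤ (1/q-nonneg q) x≤qy ⟩
  ι (+ q) * y * (+ 1 / q)     ≡⟨ solve 3 (λ q y u → q :* y :* u := y :* (u :* q)) refl (ι (+ q)) y (+ 1 / q) ⟩
  y * ((+ 1 / q) * ι (+ q))   ≡⟨ cong (y *_) (1/q*q q) ⟩
  y * 1ℚ                      ≡⟨ ℚ.*-identityʳ y ⟩
  y                           ∎
  where open ℚ.≤-Reasoning

+-*-1/q-≤ : ∀ q .{{_ : NonZero q}} {m γ F} → γ ≤ ι (+ q) * (F - m) → m + γ * (+ 1 / q) ≤ F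
+-*-1/q-≤ q {m} {γ} {F} γ≤q[F-m] = begin
  m + γ * (+ 1 / q)   ≤⟨ ℚ.+-monoʳ-≤ m (*-1/q-≤ q γ≤q[F-m]) ⟩
  m + (F - m)         ≡⟨ solve 2 (λ m F → m :+ (F :- m) := F) refl m F ⟩
  F                   ∎
  where open ℚ.≤-Reasoning

ι-denominator-pos : ∀ p → 0ℚ < ι (+ ↧ₙ p)
ι-denominator-pos p = ι-suc-pos (ℚ.ℚ.denominator-1 p)

ι-floor≤ : ∀ p → ι (floor p) ≤ p
ι-floor≤ p@record{} = ℚ.*-cancelʳ-≤-pos (ι (+ ↧ₙ p)) {{ℚ.positive (ι-denominator-pos p)}} (begin
  ι (floor p) * ι (+ ↧ₙ p)   ≡⟨ ι-* (floor p) (+ ↧ₙ p) ⟨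
  ι (floor p ℤ.* + ↧ₙ p)     ≤⟨ ι-mono-≤ (ℤ.[n/d]*d≤n (↥ p) (+ ↧ₙ p)) ⟩
  ι (↥ p)                    ≡⟨ *-denominator p ⟨
  p * ι (+ ↧ₙ p)             ∎)
  where open ℚ.≤-Reasoning

<ι-suc-floor : ∀ p → p < ι (ℤ.suc (floor p))
<ι-suc-floor p@record{} =
  ℚ.*-cancelʳ-<-nonNeg (ι (+ ↧ₙ p)) {{ℚ.nonNegative (ℚ.<⇒≤ (ι-denominator-pos p))}} (begin-strict
    p * ι (+ ↧ₙ p)                         ≡⟨ *-denominator p ⟩
    ι (↥ p)                                <⟨ ι-mono-< (ℤ.n<s[n/ℕd]*d (↥ p) (↧ₙ p)) ⟩
    ι (ℤ.suc (↥ p ℤ./ℕ ↧ₙ p) ℤ.* + ↧ₙ p)   ≡⟨ cong (λ z → ι (ℤ.suc z ℤ.* + ↧ₙ p)) floor≡/ℕ ⟨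
    ι (ℤ.suc (floor p) ℤ.* + ↧ₙ p)         ≡⟨ ι-* (ℤ.suc (floor p)) (+ ↧ₙ p) ⟩
    ι (ℤ.suc (floor p)) * ι (+ ↧ₙ p)       ∎)
  where
  open ℚ.≤-Reasoning
  floor≡/ℕ : floor p ≡ ↥ p ℤ./ℕ ↧ₙ p
  floor≡/ℕ = ℤ.div-pos-is-/ℕ (↥ p) (↧ₙ p)

-- x ∼ y: x and y are equal in ℚ/ℤ, so that InCoset b q t says t * ι (+ q) ∼ b.  A record
-- rather than a Σ-type so that x and y can be inferred from a proof.
infix 4 _∼_

record _∼_ (x y : ℚ) : Set where
  constructor mk∼
  field
    shift   : ℤ
    shifted : x ≡ y + ι shift

∼-refl : ∀ {x} → x ∼ x
∼-refl {x} = mk∼ ℤ.0ℤ (sym (ℚ.+-identityʳ x))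

∼-sym : ∀ {x y} → x ∼ y → y ∼ x
∼-sym {x} {y} (mk∼ z x≡y+z) = mk∼ (ℤ.- z) (begin
  y                   ≡⟨ solve 2 (λ y z → y := (y :+ z) :+ :- z) refl y (ι z) ⟩
  (y + ι z) + - ι z   ≡⟨ cong₂ _+_ x≡y+z (ι-neg z) ⟨
  x + ι (ℤ.- z)       ∎)
  where open ≡-Reasoning

∼-trans : ∀ {x y w} → x ∼ y → y ∼ w → x ∼ w
∼-trans {x} {y} {w} (mk∼ z x≡y+z) (mk∼ z′ y≡w+z′) = mk∼ (z′ ℤ.+ z) (begin
  x                  ≡⟨ x≡y+z ⟩
  y + ι z            ≡⟨ cong (_+ ι z) y≡w+z′ ⟩
  (w + ι z′) + ι z   ≡⟨ ℚ.+-assoc w (ι z′) (ι z) ⟩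
  w + (ι z′ + ι z)   ≡⟨ cong (_+_ w) (ι-+ z′ z) ⟨
  w + ι (z′ ℤ.+ z)   ∎)
  where open ≡-Reasoning

∼-setoid : Setoid _ _
∼-setoid = record
  { _≈_           = _∼_
  ; isEquivalence = record { refl = ∼-refl ; sym = ∼-sym ; trans = ∼-trans }
  }

∼-+ : ∀ {x y x′ y′} → x ∼ y → x′ ∼ y′ → x + x′ ∼ y + y′
∼-+ {x} {y} {x′} {y′} (mk∼ z x≡y+z) (mk∼ z′ x′≡y′+z′) = mk∼ (z ℤ.+ z′) (begin
  x + x′                    ≡⟨ cong₂ _+_ x≡y+z x′≡y′+z′ ⟩
  (y + ι z) + (y′ + ι z′)   ≡⟨ solve 4 (λ y z y′ z′ → (y :+ z) :+ (y′ :+ z′) := (y :+ y′) :+ (z :+ z′))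
                                       refl y (ι z) y′ (ι z′) ⟩
  (y + y′) + (ι z + ι z′)   ≡⟨ cong (_+_ (y + y′)) (ι-+ z z′) ⟨
  (y + y′) + ι (z ℤ.+ z′)   ∎)
  where open ≡-Reasoning

∼-*ι : ∀ i {x y} → x ∼ y → ι i * x ∼ ι i * y
∼-*ι i {x} {y} (mk∼ z x≡y+z) = mk∼ (i ℤ.* z) (begin
  ι i * x                 ≡⟨ cong (ι i *_) x≡y+z ⟩
  ι i * (y + ι z)         ≡⟨ ℚ.*-distribˡ-+ (ι i) y (ι z) ⟩
  ι i * y + ι i * ι z     ≡⟨ cong (_+_ (ι i * y)) (ι-* i z) ⟨
  ι i * y + ι (i ℤ.* z)   ∎)
  where open ≡-Reasoning

∼-- : ∀ {x y x′ y′} → x ∼ y → x′ ∼ y′ → x - x′ ∼ y - y′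
∼-- x∼y x′∼y′ = ∼-+ x∼y (subst₂ _∼_ (-1*p≡-p _) (-1*p≡-p _) (∼-*ι ℤ.-1ℤ x′∼y′))

ι∼0 : ∀ z → ι z ∼ 0ℚ
ι∼0 z = mk∼ z (sym (ℚ.+-identityˡ (ι z)))

*-∼-residue : ∀ Q k M x → ι (+ M) * x ∼ 0ℚ → ι (+ (Q ℕ.+ k ℕ.* M)) * x ∼ ι (+ Q) * x
*-∼-residue Q k M x Mx∼0 = begin
  ι (+ (Q ℕ.+ k ℕ.* M)) * x                ≡⟨ cong (_* x) (ι-pos-+ Q (k ℕ.* M)) ⟩
  (ι (+ Q) + ι (+ (k ℕ.* M))) * x          ≡⟨ cong (λ r → (ι (+ Q) + r) * x) (ι-pos-* k M) ⟩
  (ι (+ Q) + ι (+ k) * ι (+ M)) * x        ≡⟨ solve 4 (λ Q k M x → (Q :+ k :* M) :* x := Q :* x :+ k :* (M :* x))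
                                                      refl (ι (+ Q)) (ι (+ k)) (ι (+ M)) x ⟩
  ι (+ Q) * x + ι (+ k) * (ι (+ M) * x)    ≈⟨ ∼-+ (∼-refl {ι (+ Q) * x}) (∼-*ι (+ k) Mx∼0) ⟩
  ι (+ Q) * x + ι (+ k) * 0ℚ               ≡⟨ cong (_+_ (ι (+ Q) * x)) (ℚ.*-zeroʳ (ι (+ k))) ⟩
  ι (+ Q) * x + 0ℚ                         ≡⟨ ℚ.+-identityʳ _ ⟩
  ι (+ Q) * x                              ∎
  where open import Relation.Binary.Reasoning.Setoid ∼-setoid

-- y − ⌊y⌋; unlike the library's fracPart, this lies in [0, 1) also for negative y.
frac : ℚ → ℚ
frac y = y - ι (floor y)

frac∼ : ∀ y → frac y ∼ y
frac∼ y = mk∼ (ℤ.- floor y) (cong (_+_ y) (sym (ι-neg (floor y))))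

frac-nonneg : ∀ y → 0ℚ ≤ frac y
frac-nonneg y = ≤⇒0≤- (ι-floor≤ y)

frac<1 : ∀ y → frac y < 1ℚ
frac<1 y = begin-strict
  frac y                              <⟨ ℚ.+-monoˡ-< (- ι (floor y)) (<ι-suc-floor y) ⟩
  ι (ℤ.suc (floor y)) - ι (floor y)   ≡⟨ cong (_- ι (floor y)) (ι-+ ℤ.1ℤ (floor y)) ⟩
  (1ℚ + ι (floor y)) - ι (floor y)    ≡⟨ solve 1 (λ f → (con 1ℚ :+ f) :- f := con 1ℚ) refl (ι (floor y)) ⟩
  1ℚ                                  ∎
  where open ℚ.≤-Reasoning

frac-least : ∀ {x y} → x ∼ y → 0ℚ ≤ x → frac y ≤ x
frac-least {x} {y} (mk∼ z x≡y+z) 0≤x = begin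
  frac y                         ≡⟨ ℚ.+-identityʳ (frac y) ⟨
  frac y + 0ℚ                    ≤⟨ ℚ.+-monoʳ-≤ (frac y) (ι-mono-≤ 0≤w) ⟩
  frac y + ι w                   ≡⟨ cong (_+_ (frac y)) (ι-+ (floor y) z) ⟩
  frac y + (ι (floor y) + ι z)   ≡⟨ solve 3 (λ y f z → (y :- f) :+ (f :+ z) := y :+ z) refl y (ι (floor y)) (ι z) ⟩
  y + ι z                        ≡⟨ x≡y+z ⟨
  x                              ∎
  where
  open ℚ.≤-Reasoning
  -- x − frac y is the integer w, and w + 1 > 0 because x ≥ 0 and frac y < 1.
  w = floor y ℤ.+ z
  x<suc-w : x < ι (ℤ.suc w)
  x<suc-w = begin-strict
    x                           ≡⟨ x≡y+z ⟩
    y + ι z                     <⟨ ℚ.+-monoˡ-< (ι z) (<ι-suc-floor y) ⟩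
    ι (ℤ.suc (floor y)) + ι z   ≡⟨ ι-+ (ℤ.suc (floor y)) z ⟨
    ι (ℤ.suc (floor y) ℤ.+ z)   ≡⟨ cong ι (ℤ.+-assoc ℤ.1ℤ (floor y) z) ⟩
    ι (ℤ.suc w)                 ∎
  0≤w : ℤ.0ℤ ℤ.≤ w
  0≤w = subst (ℤ.0ℤ ℤ.≤_) (ℤ.pred-suc w)
          (ℤ.i<j⇒i≤pred[j] (ι-cancel-< {ℤ.0ℤ} {ℤ.suc w} (ℚ.≤-<-trans 0≤x x<suc-w)))

archimedean : ∀ p → Σ ℕ λ K → p ≤ ι (+ K)
archimedean p = bound (ℤ.suc (floor p)) (<ι-suc-floor p)
  where
  bound : ∀ i → p < ι i → Σ ℕ λ K → p ≤ ι (+ K)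
  bound (+ K)     p<i = K , ℚ.<⇒≤ p<i
  bound -[1+ n ] p<i = 0 , ℚ.<⇒≤ (ℚ.<-trans p<i (ι-mono-< { -[1+ n ]} {ℤ.0ℤ} ℤ.-<+))

Eventually : (ℕ → Set) → Set
Eventually P = Σ ℕ λ N → ∀ q → N ℕ.≤ q → P q

eventually-× : ∀ {P R : ℕ → Set} → Eventually P → Eventually R → Eventually (λ q → P q × R q)
eventually-× (N , P-from-N) (N′ , R-from-N′) = N ℕ.⊔ N′ , λ q N⊔N′≤q →
  P-from-N q (ℕ.≤-trans (ℕ.m≤m⊔n N N′) N⊔N′≤q) , R-from-N′ q (ℕ.≤-trans (ℕ.m≤n⊔m N N′) N⊔N′≤q)

eventually-∀ : ∀ k {P : Fin k → ℕ → Set} → (∀ j → Eventually (P j)) → Eventually (λ q → ∀ j → P j q)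
eventually-∀ ℕ.zero    _  = 0 , λ _ _ ()
eventually-∀ (ℕ.suc k) ev with eventually-× (ev zero) (eventually-∀ k (ev ∘ suc))
... | N , both = N , λ where
  q N≤q zero    → proj₁ (both q N≤q)
  q N≤q (suc j) → proj₂ (both q N≤q) j

eventually-≤-* : ∀ {a} → 0ℚ < a → ∀ γ → Eventually (λ q → γ ≤ ι (+ q) * a)
eventually-≤-* {a@record{}} 0<a γ = K ℕ.* ↧ₙ a , λ q K*d≤q → begin
  γ                            ≤⟨ γ≤K ⟩
  ι (+ K)                      ≡⟨ ℚ.*-identityʳ (ι (+ K)) ⟨
  ι (+ K) * 1ℚ                 ≤⟨ *-monoˡ-≤-0≤ (ι-ℕ-nonneg K) (ι-mono-≤ 1≤↥a) ⟩
  ι (+ K) * ι (↥ a)            ≡⟨ cong (ι (+ K) *_) (*-denominator a) ⟨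
  ι (+ K) * (a * ι (+ ↧ₙ a))   ≡⟨ solve 3 (λ k a d → k :* (a :* d) := (k :* d) :* a)
                                            refl (ι (+ K)) a (ι (+ ↧ₙ a)) ⟩
  ι (+ K) * ι (+ ↧ₙ a) * a     ≡⟨ cong (_* a) (ι-pos-* K (↧ₙ a)) ⟨
  ι (+ (K ℕ.* ↧ₙ a)) * a       ≤⟨ *-monoʳ-≤-0≤ (ℚ.<⇒≤ 0<a) (ι-mono-≤ (ℤ.+≤+ K*d≤q)) ⟩
  ι (+ q) * a                  ∎
  where
  open ℚ.≤-Reasoning
  K = proj₁ (archimedean γ)
  γ≤K = proj₂ (archimedean γ)
  1≤↥a : ℤ.1ℤ ℤ.≤ ↥ a
  1≤↥a = ℤ.i<j⇒suc[i]≤j (ℤ.positive⁻¹ (↥ a) {{ℚ.positive 0<a}})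

eventually-≢⇒≤-* : ∀ {m F} → m ≤ F → ∀ γ → Eventually (λ q → F ≢ m → γ ≤ ι (+ q) * (F - m))
eventually-≢⇒≤-* {m} {F} m≤F γ = by-cases (m ℚ.<? F)
  where
  by-cases : Dec (m < F) → Eventually (λ q → F ≢ m → γ ≤ ι (+ q) * (F - m))
  by-cases (yes m<F) = let (N , γ≤) = eventually-≤-* (<⇒0<- m<F) γ in N , λ q N≤q _ → γ≤ q N≤q
  by-cases (no  m≮F) = 0 , λ _ _ F≢m → ⊥-elim (F≢m (ℚ.≤-antisym (ℚ.≮⇒≥ m≮F) m≤F))

segment-containing : ∀ n (xs : Fin (ℕ.suc n) → ℚ) {u} → xs zero ≤ u → u < xs (fromℕ n) →
                     Σ (Fin n) λ i → xs (inject₁ i) ≤ u × u ≤ xs (suc i)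
segment-containing ℕ.zero    xs x₀≤u u<x₀ = ⊥-elim (ℚ.<-irrefl refl (ℚ.≤-<-trans x₀≤u u<x₀))
segment-containing (ℕ.suc n) xs {u} x₀≤u u<xₙ with u ℚ.<? xs (suc zero)
... | yes u<x₁ = zero , x₀≤u , ℚ.<⇒≤ u<x₁
... | no  u≮x₁ with segment-containing n (xs ∘ suc) (ℚ.≮⇒≥ u≮x₁) u<xₙ
...   | i , xᵢ≤u , u≤xᵢ₊₁ = suc i , xᵢ≤u , u≤xᵢ₊₁

common-denominator : ∀ k (xs : Fin k → ℚ) → Σ ℕ λ M → 1 ℕ.≤ M × (∀ j → ι (+ M) * xs j ∼ 0ℚ)
common-denominator ℕ.zero    xs = 1 , ℕ.≤-refl , λ ()
common-denominator (ℕ.suc k) xs with common-denominator k (xs ∘ suc)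
... | M , 1≤M , M-clears = d ℕ.* M , ℕ.*-mono-≤ {1} {d} (ℕ.s≤s ℕ.z≤n) 1≤M , λ
  { zero    → subst (_∼ 0ℚ) (sym clears-x₀) (ι∼0 (+ M ℤ.* ↥ xs zero))
  ; (suc j) → subst₂ _∼_ (sym (reassoc (xs (suc j)))) (ℚ.*-zeroʳ (ι (+ d))) (∼-*ι (+ d) (M-clears j))
  }
  where
  open ≡-Reasoning
  d = ↧ₙ xs zero
  reassoc : ∀ x → ι (+ (d ℕ.* M)) * x ≡ ι (+ d) * (ι (+ M) * x)
  reassoc x = trans (cong (_* x) (ι-pos-* d M)) (ℚ.*-assoc (ι (+ d)) (ι (+ M)) x)
  clears-x₀ : ι (+ (d ℕ.* M)) * xs zero ≡ ι (+ M ℤ.* ↥ xs zero)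
  clears-x₀ = begin
    ι (+ (d ℕ.* M)) * xs zero       ≡⟨ reassoc (xs zero) ⟩
    ι (+ d) * (ι (+ M) * xs zero)   ≡⟨ solve 3 (λ d m x → d :* (m :* x) := m :* (x :* d))
                                                 refl (ι (+ d)) (ι (+ M)) (xs zero) ⟩
    ι (+ M) * (xs zero * ι (+ d))   ≡⟨ cong (ι (+ M) *_) (*-denominator (xs zero)) ⟩
    ι (+ M) * ι (↥ xs zero)         ≡⟨ ι-* (+ M) (↥ xs zero) ⟨
    ι (+ M ℤ.* ↥ xs zero)           ∎

argmin-on : ∀ {A : Set} (c : A → ℚ) {P : A → Set} → Decidable P → (xs : List A) → (∀ x → x ∈ xs) →
            Σ A P → Σ A λ x → P x × (∀ y → P y → c x ≤ c y)
argmin-on c P? xs complete (x₀ , Px₀) =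
  argmin c x₀ candidates ,
  argmin-all c Px₀ (all-filter P? xs) ,
  λ y Py → lookup (f[argmin]≤f[xs] x₀ candidates) (∈-filter⁺ P? (complete y) Py)
  where candidates = filter P? xs

data End : Set where
  left right : End

ends : List End
ends = left ∷ right ∷ []

∈-ends : ∀ e → e ∈ ends
∈-ends left  = here refl
∈-ends right = there (here refl)

-- A piece is parametrised from either of its ends as t = endpoint + orientation · distance,
-- so that everything said about the left end holds for the right end with orientation −1.
orientation : End → ℤ
orientation left  = ℤ.1ℤ
orientation right = ℤ.-1ℤ

orientation² : ∀ e x → ι (orientation e) * (ι (orientation e) * x) ≡ x
orientation² e x = trans (sym (ℚ.*-assoc σ σ x)) (trans (cong (_* x) (σ² e)) (ℚ.*-identityˡ x))
  where
  σ = ι (orientation e)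
  σ² : ∀ e′ → ι (orientation e′) * ι (orientation e′) ≡ 1ℚ
  σ² left  = refl
  σ² right = refl

module PiecewiseLinear {f : ℚ → ℚ} (pl : IsPL f) where
  open IsPL pl

  periodic-∼ : ∀ {x y} → x ∼ y → f x ≡ f y
  periodic-∼ {x} {y} (mk∼ z x≡y+z) = trans (cong f x≡y+z) (shift-invariant z y)
    where
    shift-invariant-ℕ : ∀ k t → f (t + ι (+ k)) ≡ f t
    shift-invariant-ℕ ℕ.zero    t = cong f (ℚ.+-identityʳ t)
    shift-invariant-ℕ (ℕ.suc k) t = begin
      f (t + ι (+ ℕ.suc k))    ≡⟨ cong (λ r → f (t + r)) (ι-+ ℤ.1ℤ (+ k)) ⟩
      f (t + (1ℚ + ι (+ k)))   ≡⟨ cong f (solve 2 (λ t r → t :+ (con 1ℚ :+ r) := (t :+ r) :+ con 1ℚ)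
                                                   refl t (ι (+ k))) ⟩
      f ((t + ι (+ k)) + 1ℚ)   ≡⟨ periodic (t + ι (+ k)) ⟩
      f (t + ι (+ k))          ≡⟨ shift-invariant-ℕ k t ⟩
      f t                      ∎
      where open ≡-Reasoning
    shift-invariant : ∀ z t → f (t + ι z) ≡ f t
    shift-invariant (+ k)     t = shift-invariant-ℕ k t
    shift-invariant -[1+ k ] t = begin
      f (t + ι -[1+ k ])                     ≡⟨ shift-invariant-ℕ (ℕ.suc k) (t + ι -[1+ k ]) ⟨
      f ((t + ι -[1+ k ]) + ι (+ ℕ.suc k))   ≡⟨ cong f (ℚ.+-assoc t _ _) ⟩
      f (t + (ι -[1+ k ] + ι (+ ℕ.suc k)))   ≡⟨ cong (λ r → f (t + r)) (ι-+ -[1+ k ] (+ ℕ.suc k)) ⟨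
      f (t + ι (-[1+ k ] ℤ.+ + ℕ.suc k))     ≡⟨ cong (λ r → f (t + ι r)) (ℤ.+-inverseˡ (+ ℕ.suc k)) ⟩
      f (t + 0ℚ)                             ≡⟨ cong f (ℚ.+-identityʳ t) ⟩
      f t                                    ∎
      where open ≡-Reasoning

  InPiece : Fin n → ℚ → Set
  InPiece i t = xs (inject₁ i) ≤ t × t ≤ xs (suc i)

  frac-inPiece : ∀ t → Σ (Fin n) λ i → InPiece i (frac t)
  frac-inPiece t = segment-containing n xs (subst (_≤ frac t) (sym x-first) (frac-nonneg t))
                                           (subst (frac t <_) (sym x-last) (frac<1 t))

  length : Fin n → ℚ
  length i = xs (suc i) - xs (inject₁ i)

  length-pos : ∀ i → 0ℚ < length i
  length-pos i = <⇒0<- (x-incr i)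

  endpointIndex : Fin n → End → Fin (ℕ.suc n)
  endpointIndex i left  = inject₁ i
  endpointIndex i right = suc i

  endpoint : Fin n → End → ℚ
  endpoint i e = xs (endpointIndex i e)

  distance : Fin n → End → ℚ → ℚ
  distance i e t = ι (orientation e) * (t - endpoint i e)

  pointAt : Fin n → End → ℚ → ℚ
  pointAt i e d = endpoint i e + ι (orientation e) * d

  inwardSlope : Fin n → End → ℚ
  inwardSlope i e = ι (orientation e) * slopes i

  f-from-end : ∀ i e {t} → InPiece i t → f t ≡ f (endpoint i e) + inwardSlope i e * distance i e t
  f-from-end i e {t} t∈i = begin
    f t                                                             ≡⟨ affine-from e ⟩
    f (endpoint i e) + slopes i * (t - endpoint i e)                ≡⟨ cong (_+_ (f (endpoint i e))) (orientation² e _) ⟨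
    f (endpoint i e) + σ * (σ * (slopes i * (t - endpoint i e)))    ≡⟨ cong (_+_ (f (endpoint i e))) (reorder σ (slopes i) _) ⟩
    f (endpoint i e) + inwardSlope i e * distance i e t             ∎
    where
    open ≡-Reasoning
    σ = ι (orientation e)
    L = xs (inject₁ i)
    R = xs (suc i)
    reorder : ∀ σ s d → σ * (σ * (s * d)) ≡ (σ * s) * (σ * d)
    reorder = solve 3 (λ σ s d → σ :* (σ :* (s :* d)) := (σ :* s) :* (σ :* d)) refl
    affine-from : ∀ e → f t ≡ f (endpoint i e) + slopes i * (t - endpoint i e)
    affine-from left  = affine i t (proj₁ t∈i) (proj₂ t∈i)
    affine-from right = begin
      f t                                               ≡⟨ affine i t (proj₁ t∈i) (proj₂ t∈i) ⟩
      f L + slopes i * (t - L)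
        ≡⟨ solve 5 (λ a s t l r → a :+ s :* (t :- l) := (a :+ s :* (r :- l)) :+ s :* (t :- r)) refl (f L) (slopes i) t L R ⟩
      (f L + slopes i * (R - L)) + slopes i * (t - R)
        ≡⟨ cong (_+ slopes i * (t - R)) (affine i R (ℚ.<⇒≤ (x-incr i)) ℚ.≤-refl) ⟨
      f R + slopes i * (t - R)
        ∎

  distance-nonneg : ∀ i e {t} → InPiece i t → 0ℚ ≤ distance i e t
  distance-nonneg i left  {t} (L≤t , _) = subst (0ℚ ≤_) (sym (ℚ.*-identityˡ _)) (≤⇒0≤- L≤t)
  distance-nonneg i right {t} (_ , t≤R) = subst (0ℚ ≤_) R-t≡distance (≤⇒0≤- t≤R)
    where
    R-t≡distance : xs (suc i) - t ≡ distance i right t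
    R-t≡distance = trans (solve 2 (λ r t → r :- t := :- (t :- r)) refl (xs (suc i)) t) (sym (-1*p≡-p _))

  distance-pointAt : ∀ i e d → distance i e (pointAt i e d) ≡ d
  distance-pointAt i e d =
    trans (cong (ι (orientation e) *_) (solve 2 (λ a x → (a :+ x) :- a := x) refl (endpoint i e) _)) (orientation² e d)

  pointAt-inPiece : ∀ i e {d} → 0ℚ ≤ d → d ≤ length i → InPiece i (pointAt i e d)
  pointAt-inPiece i left {d} 0≤d d≤len = L≤ , ≤R
    where
    open ℚ.≤-Reasoning
    L = xs (inject₁ i)
    R = xs (suc i)
    L≤ : L ≤ L + 1ℚ * d
    L≤ = begin
      L            ≤⟨ p≤p+q L 0≤d ⟩
      L + d        ≡⟨ cong (_+_ L) (ℚ.*-identityˡ d) ⟨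
      L + 1ℚ * d   ∎
    ≤R : L + 1ℚ * d ≤ R
    ≤R = begin
      L + 1ℚ * d    ≡⟨ cong (_+_ L) (ℚ.*-identityˡ d) ⟩
      L + d         ≤⟨ ℚ.+-monoʳ-≤ L d≤len ⟩
      L + (R - L)   ≡⟨ solve 2 (λ l r → l :+ (r :- l) := r) refl L R ⟩
      R             ∎
  pointAt-inPiece i right {d} 0≤d d≤len = L≤ , ≤R
    where
    open ℚ.≤-Reasoning
    L = xs (inject₁ i)
    R = xs (suc i)
    L≤ : L ≤ R + ι ℤ.-1ℤ * d
    L≤ = begin
      L                 ≡⟨ solve 2 (λ l r → l := r :+ :- (r :- l)) refl L R ⟩
      R + - (R - L)     ≤⟨ ℚ.+-monoʳ-≤ R (ℚ.neg-antimono-≤ d≤len) ⟩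
      R + - d           ≡⟨ cong (_+_ R) (-1*p≡-p d) ⟨
      R + ι ℤ.-1ℤ * d   ∎
    ≤R : R + ι ℤ.-1ℤ * d ≤ R
    ≤R = begin
      R + ι ℤ.-1ℤ * d   ≡⟨ cong (_+_ R) (-1*p≡-p d) ⟩
      R + - d           ≤⟨ ℚ.+-monoʳ-≤ R (ℚ.neg-antimono-≤ 0≤d) ⟩
      R + 0ℚ            ≡⟨ ℚ.+-identityʳ R ⟩
      R                 ∎

  f-pointAt : ∀ i e {d} → 0ℚ ≤ d → d ≤ length i → f (pointAt i e d) ≡ f (endpoint i e) + inwardSlope i e * d
  f-pointAt i e 0≤d d≤len =
    trans (f-from-end i e (pointAt-inPiece i e 0≤d d≤len))
          (cong (λ r → f (endpoint i e) + inwardSlope i e * r) (distance-pointAt i e _))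

  upward-end : ∀ i → Σ End λ e → 0ℚ ≤ inwardSlope i e
  upward-end i with 0ℚ ℚ.≤? slopes i
  ... | yes 0≤s = left  , subst (0ℚ ≤_) (sym (ℚ.*-identityˡ (slopes i))) 0≤s
  ... | no  0≰s = right , subst (0ℚ ≤_) (sym (-1*p≡-p (slopes i))) (ℚ.neg-antimono-≤ (ℚ.<⇒≤ (ℚ.≰⇒> 0≰s)))

  f-endpoint≤ : ∀ i e {t} → 0ℚ ≤ inwardSlope i e → InPiece i t → f (endpoint i e) ≤ f t
  f-endpoint≤ i e 0≤slope t∈i = subst (f (endpoint i e) ≤_) (sym (f-from-end i e t∈i))
    (p≤p+q (f (endpoint i e)) (nonneg-* 0≤slope (distance-nonneg i e t∈i)))

  module Minimum {m : ℚ} (m≤f : ∀ t → m ≤ f t) {t₀ : ℚ} (ft₀≡m : f t₀ ≡ m) where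

    inwardSlope-nonneg : ∀ i e → f (endpoint i e) ≡ m → 0ℚ ≤ inwardSlope i e
    inwardSlope-nonneg i e fa≡m = ℚ.*-cancelʳ-≤-pos (length i) {{ℚ.positive (length-pos i)}}
      (subst₂ _≤_ (sym (ℚ.*-zeroˡ (length i))) rise (≤⇒0≤- (m≤f (pointAt i e (length i)))))
      where
      rise : f (pointAt i e (length i)) - m ≡ inwardSlope i e * length i
      rise = begin
        f (pointAt i e (length i)) - m                        ≡⟨ cong (_- m) (f-pointAt i e (ℚ.<⇒≤ (length-pos i)) ℚ.≤-refl) ⟩
        (f (endpoint i e) + inwardSlope i e * length i) - m   ≡⟨ cong (λ r → (r + inwardSlope i e * length i) - m) fa≡m ⟩
        (m + inwardSlope i e * length i) - m                  ≡⟨ solve 2 (λ m x → (m :+ x) :- m := x) refl m _ ⟩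
        inwardSlope i e * length i                            ∎
        where open ≡-Reasoning

    Side : Set
    Side = Fin n × End

    sides : List Side
    sides = cartesianProduct (allFin n) ends

    ∈-sides : ∀ s → s ∈ sides
    ∈-sides (i , e) = ∈-cartesianProduct⁺ (∈-allFin i) (∈-ends e)

    MinimalSide : Side → Set
    MinimalSide (i , e) = f (endpoint i e) ≡ m

    minimalSide? : Decidable MinimalSide
    minimalSide? (i , e) = f (endpoint i e) ℚ.≟ m

    minimalSide-exists : Σ Side MinimalSide
    minimalSide-exists = (i , e) , ℚ.≤-antisym fa≤m (m≤f (endpoint i e))
      where
      i = proj₁ (frac-inPiece t₀)
      e = proj₁ (upward-end i)
      fa≤m : f (endpoint i e) ≤ m
      fa≤m = subst (f (endpoint i e) ≤_) (trans (periodic-∼ (frac∼ t₀)) ft₀≡m)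
                   (f-endpoint≤ i e (proj₂ (upward-end i)) (proj₂ (frac-inPiece t₀)))

    module ResidueClass (M : ℕ) (M-clears : ∀ j → ι (+ M) * xs j ∼ 0ℚ) (b : ℚ) (Q : ℕ) where

      offset : Side → ℚ
      offset (i , e) = ι (orientation e) * (b - ι (+ Q) * endpoint i e)

      distance-∼-offset : ∀ i e q k t → q ≡ Q ℕ.+ k ℕ.* M → t * ι (+ q) ∼ b →
                          ι (+ q) * distance i e t ∼ offset (i , e)
      distance-∼-offset i e q k t refl tq∼b = begin
        ι (+ q) * (σ * (t - a))           ≡⟨ solve 4 (λ q σ t a → q :* (σ :* (t :- a)) := σ :* (t :* q :- q :* a))
                                                     refl (ι (+ q)) σ t a ⟩
        σ * (t * ι (+ q) - ι (+ q) * a)   ≈⟨ ∼-*ι (orientation e) (∼-- tq∼b qa∼Qa) ⟩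
        σ * (b - ι (+ Q) * a)             ∎
        where
        open import Relation.Binary.Reasoning.Setoid ∼-setoid
        σ = ι (orientation e)
        a = endpoint i e
        qa∼Qa = *-∼-residue Q k M a (M-clears (endpointIndex i e))

      pointAt-∼ : ∀ i e q k .{{_ : NonZero q}} → q ≡ Q ℕ.+ k ℕ.* M →
                  pointAt i e (frac (offset (i , e)) * (+ 1 / q)) * ι (+ q) ∼ b
      pointAt-∼ i e q k refl = begin
        (a + σ * (frac y * (+ 1 / q))) * ι (+ q)
          ≡⟨ solve 5 (λ a σ φ u q → (a :+ σ :* (φ :* u)) :* q := q :* a :+ σ :* (φ :* (u :* q)))
                     refl a σ (frac y) (+ 1 / q) (ι (+ q)) ⟩
        ι (+ q) * a + σ * (frac y * ((+ 1 / q) * ι (+ q)))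
          ≡⟨ cong (λ r → ι (+ q) * a + σ * (frac y * r)) (1/q*q q) ⟩
        ι (+ q) * a + σ * (frac y * 1ℚ)
          ≡⟨ cong (λ r → ι (+ q) * a + σ * r) (ℚ.*-identityʳ (frac y)) ⟩
        ι (+ q) * a + σ * frac y
          ≈⟨ ∼-+ (*-∼-residue Q k M a (M-clears (endpointIndex i e))) (∼-*ι (orientation e) (frac∼ y)) ⟩
        ι (+ Q) * a + σ * (σ * (b - ι (+ Q) * a))
          ≡⟨ cong (_+_ (ι (+ Q) * a)) (orientation² e _) ⟩
        ι (+ Q) * a + (b - ι (+ Q) * a)
          ≡⟨ solve 2 (λ x b → x :+ (b :- x) := b) refl (ι (+ Q) * a) b ⟩
        b ∎
        where
        open import Relation.Binary.Reasoning.Setoid ∼-setoid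
        σ = ι (orientation e)
        a = endpoint i e
        y = offset (i , e)

      cost : Side → ℚ
      cost (i , e) = inwardSlope i e * frac (offset (i , e))

      best : Σ Side λ s → MinimalSide s × (∀ s′ → MinimalSide s′ → cost s ≤ cost s′)
      best = argmin-on cost minimalSide? sides ∈-sides minimalSide-exists

      i* : Fin n
      i* = proj₁ (proj₁ best)

      e* : End
      e* = proj₂ (proj₁ best)

      γ : ℚ
      γ = cost (i* , e*)

      γ-nonneg : 0ℚ ≤ γ
      γ-nonneg = nonneg-* (inwardSlope-nonneg i* e* (proj₁ (proj₂ best))) (frac-nonneg (offset (i* , e*)))

      LargeEnough : ℕ → Set
      LargeEnough q = (∀ j → f (xs j) ≢ m → γ ≤ ι (+ q) * (f (xs j) - m)) × 1ℚ ≤ ι (+ q) * length i*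

      large-enough : Eventually LargeEnough
      large-enough = eventually-× (eventually-∀ (ℕ.suc n) λ j → eventually-≢⇒≤-* (m≤f (xs j)) γ)
                                  (eventually-≤-* (length-pos i*) 1ℚ)

      lower-bound : ∀ q k .{{_ : NonZero q}} → LargeEnough q → q ≡ Q ℕ.+ k ℕ.* M →
                    ∀ t → InCoset b q t → m + γ * (+ 1 / q) ≤ f t
      lower-bound q k (above , _) q≡ t (r , tq≡b+r) =
        subst (m + γ * (+ 1 / q) ≤_) (periodic-∼ (frac∼ t)) (+-*-1/q-≤ q (γ≤ (f a ℚ.≟ m)))
        where
        u = frac t
        i = proj₁ (frac-inPiece t)
        u∈i = proj₂ (frac-inPiece t)
        e = proj₁ (upward-end i)
        0≤slope = proj₂ (upward-end i)
        a = endpoint i e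
        d = distance i e u
        uq∼b : u * ι (+ q) ∼ b
        uq∼b = ∼-trans (subst₂ _∼_ (ℚ.*-comm (ι (+ q)) u) (ℚ.*-comm (ι (+ q)) t) (∼-*ι (+ q) (frac∼ t)))
                       (mk∼ r tq≡b+r)
        γ≤ : Dec (f a ≡ m) → γ ≤ ι (+ q) * (f u - m)
        γ≤ (yes fa≡m) = begin
          γ                                       ≤⟨ proj₂ (proj₂ best) (i , e) fa≡m ⟩
          inwardSlope i e * frac (offset (i , e)) ≤⟨ *-monoˡ-≤-0≤ 0≤slope frac≤qd ⟩
          inwardSlope i e * (ι (+ q) * d)         ≡⟨ solve 4 (λ s q d m → s :* (q :* d) := q :* ((m :+ s :* d) :- m))
                                                              refl (inwardSlope i e) (ι (+ q)) d m ⟩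
          ι (+ q) * ((m + inwardSlope i e * d) - m) ≡⟨ cong (λ r → ι (+ q) * (r - m)) fu≡m+sd ⟨
          ι (+ q) * (f u - m)                     ∎
          where
          open ℚ.≤-Reasoning
          frac≤qd : frac (offset (i , e)) ≤ ι (+ q) * d
          frac≤qd = frac-least (distance-∼-offset i e q k u q≡ uq∼b)
                               (nonneg-* (ι-ℕ-nonneg q) (distance-nonneg i e u∈i))
          fu≡m+sd : f u ≡ m + inwardSlope i e * d
          fu≡m+sd = trans (f-from-end i e u∈i) (cong (_+ inwardSlope i e * d) fa≡m)
        γ≤ (no fa≢m) = begin
          γ                     ≤⟨ above (endpointIndex i e) fa≢m ⟩
          ι (+ q) * (f a - m)   ≤⟨ *-monoˡ-≤-0≤ (ι-ℕ-nonneg q) (ℚ.+-monoˡ-≤ (- m) (f-endpoint≤ i e 0≤slope u∈i)) ⟩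
          ι (+ q) * (f u - m)   ∎
          where open ℚ.≤-Reasoning

      attained : ∀ q k .{{_ : NonZero q}} → LargeEnough q → q ≡ Q ℕ.+ k ℕ.* M →
                 Σ ℚ λ t → InCoset b q t × f t ≡ m + γ * (+ 1 / q)
      attained q k (_ , 1≤q·len) q≡ = pointAt i* e* d , (_∼_.shift tq∼b , _∼_.shifted tq∼b) , value
        where
        y = offset (i* , e*)
        d = frac y * (+ 1 / q)
        tq∼b = pointAt-∼ i* e* q k q≡
        0≤d : 0ℚ ≤ d
        0≤d = nonneg-* (frac-nonneg y) (1/q-nonneg q)
        d≤len : d ≤ length i*
        d≤len = *-1/q-≤ q (ℚ.≤-trans (ℚ.<⇒≤ (frac<1 y)) 1≤q·len)
        value : f (pointAt i* e* d) ≡ m + γ * (+ 1 / q)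
        value = trans (f-pointAt i* e* 0≤d d≤len)
                      (cong₂ _+_ (proj₁ (proj₂ best)) (sym (ℚ.*-assoc (inwardSlope i* e*) (frac y) (+ 1 / q))))

lemma2p5 : (f : ℚ → ℚ) → IsPL f → (b : ℚ) → (m : ℚ) → IsMinOn Everywhere f m →
    Σ ℕ λ M → (1 ℕ.≤ M) ×
      ((Q : ℕ) → Q ℕ.< M →
        Σ ℚ λ γ → (0ℚ ≤ γ) ×
          (Σ ℕ λ q₀ → (q : ℕ) → .{{_ : NonZero q}} → q₀ ℕ.≤ q →
            (Σ ℕ λ k → q ≡ Q ℕ.+ k ℕ.* M) →
            IsMinOn (InCoset b q) f (m + γ * (+ 1 / q))))
lemma2p5 f pl b m (m≤f , t₀ , _ , ft₀≡m) = M , 1≤M , λ Q _ →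
  γ Q , γ-nonneg Q , proj₁ (large-enough Q) , λ q q₀≤q (k , q≡) →
    let q-large = proj₂ (large-enough Q) q q₀≤q
    in lower-bound Q q k q-large q≡ , attained Q q k q-large q≡
  where
  open IsPL pl using (n; xs)
  open PiecewiseLinear pl
  open Minimum (λ t → m≤f t _) ft₀≡m
  M = proj₁ (common-denominator (ℕ.suc n) xs)
  1≤M = proj₁ (proj₂ (common-denominator (ℕ.suc n) xs))
  open ResidueClass M (proj₂ (proj₂ (common-denominator (ℕ.suc n) xs))) b
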